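{- Let $P=([n],\preceq)$ be a poset, $w$ a weight on $\mathbb{F}_q$, and $\mathbb{C}\subseteq\mathbb{F}_q^n$ a code with $|\mathbb{C}|\ge2$ and minimum distance $d_{(P,w)}(\mathbb{C})$. Then $\big\lfloor\frac{d_{(P,w)}(\mathbb{C})-1}{M_w}\big\rfloor\le n-\lceil\log_q|\mathbb{C}|\rceil$.
   Context: A weight on $\mathbb{F}_q$ is a map $w:\mathbb{F}_q\to\mathbb{N}\cup\{0\}$ with $w(\alpha)=0$ iff $\alpha=0$, $w(-\alpha)=w(\alpha)$, $w(\alpha+\beta)\le w(\alpha)+w(\beta)$; $M_w=\max_\alpha w(\alpha)$. Ideals of $P$ are down-closed subsets; $\langle A\rangle$ is the ideal generated by $A$. For $u\in\mathbb{F}_q^n$, $supp(u)=\{i:u_i\ne0\}$, $I_u=\langle supp(u)\rangle$, $M_u$ the set of maximal elements of $I_u$, $w_{(P,w)}(u)=\sum_{i\in M_u}w(u_i)+|I_u\setminus M_u|\,M_w$, $d_{(P,w)}(u,v)=w_{(P,w)}(u-v)$, and $d_{(P,w)}(\mathbb{C})$ is the minimum distance between distinct codewords. -}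

module Defs where

open import Level using (0ℓ)
open import Data.Bool using (Bool; true; false; if_then_else_)
open import Data.Nat using (ℕ; zero; suc; _+_; _*_; _∸_; _^_; _≤_; _≤ᵇ_; _⊔_; _/_)
open import Data.Fin using (Fin)
open import Data.Fin.Properties using (any?; all?)
open import Data.Vec using (Vec; lookup; zipWith; tabulate; foldr′)
open import Data.List using (List; length)
open import Data.List.Membership.Propositional using (_∈_)
open import Data.Product using (Σ; ∃; _×_; _,_)
open import Data.Sum using (_⊎_)
open import Relation.Nullary using (¬_; Dec; yes; no; _×-dec_; ¬?)
open import Relation.Nullary.Decidable using (⌊_⌋)
open import Relation.Binary using (Rel; Decidable; IsDecPartialOrder)
open import Relation.Binary.PropositionalEquality using (_≡_; _≢_)
open import Algebra.Structures using (IsCommutativeRing)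
open import Function.Bundles using (_↔_; Inverse; _⇔_)

record FiniteField (q : ℕ) : Set₁ where
  field
    Carrier : Set
    _⊕_ _⊛_ : Carrier → Carrier → Carrier
    ⊝_      : Carrier → Carrier
    0# 1#   : Carrier
    isCommutativeRing : IsCommutativeRing _≡_ _⊕_ _⊛_ ⊝_ 0# 1#
    0≢1     : 0# ≢ 1#
    inverse : ∀ x → x ≢ 0# → ∃ λ y → x ⊛ y ≡ 1#
    _≟_     : Decidable {A = Carrier} _≡_
    enum    : Fin q ↔ Carrier

module _ {q : ℕ} (𝔽 : FiniteField q) where
  open FiniteField 𝔽

  record Weight : Set where
    field
      w        : Carrier → ℕ
      w-zero   : ∀ α → (w α ≡ 0 ⇔ α ≡ 0#)
      w-neg    : ∀ α → w (⊝ α) ≡ w α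
      w-tri    : ∀ α β → w (α ⊕ β) ≤ w α + w β

  Mw : Weight → ℕ
  Mw W = foldr′ _⊔_ 0 (tabulate (λ i → Weight.w W (Inverse.to enum i)))

record FinPoset (n : ℕ) : Set₁ where
  field
    _≼_ : Rel (Fin n) 0ℓ
    isDecPartialOrder : IsDecPartialOrder _≡_ _≼_
  open IsDecPartialOrder isDecPartialOrder public using () renaming (_≤?_ to _≼?_)

Σ[_] : ∀ {n} → (Fin n → ℕ) → ℕ
Σ[ f ] = foldr′ _+_ 0 (tabulate f)

-- ⌊ m / k ⌋ (k = 0 sends to 0; M_w ≥ 1 always holds here)
floorDiv : ℕ → ℕ → ℕ
floorDiv m zero    = 0
floorDiv m (suc k) = m / suc k

-- ⌈ log_q m ⌉ : least k with m ≤ q^k (searched for k ∈ [0, m]; correct for q ≥ 2, m ≥ 1)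
ceilLog : ℕ → ℕ → ℕ
ceilLog q m = go m 0
  where
  go : ℕ → ℕ → ℕ
  go zero    k = k
  go (suc f) k = if m ≤ᵇ q ^ k then k else go f (suc k)

module _ {q n : ℕ} (𝔽 : FiniteField q) (P : FinPoset n) (W : Weight 𝔽) where
  open FiniteField 𝔽
  open FinPoset P
  open Weight W

  supp : Vec Carrier n → Fin n → Set
  supp u i = lookup u i ≢ 0#

  supp? : ∀ u i → Dec (supp u i)
  supp? u i = ¬? (lookup u i ≟ 0#)

  inI : Vec Carrier n → Fin n → Set
  inI u j = ∃ λ i → supp u i × (j ≼ i)

  inI? : ∀ u j → Dec (inI u j)
  inI? u j = any? (λ i → supp? u i ×-dec (j ≼? i))

  inM : Vec Carrier n → Fin n → Set
  inM u j = inI u j × (∀ k → inI u k → j ≼ k → k ≡ j)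

  inM? : ∀ u j → Dec (inM u j)
  inM? u j = inI? u j ×-dec all? (λ k → decImp (inI? u k) (decImp (j ≼? k) (k ≟' j)))
    where
    open import Data.Fin using () renaming (_≟_ to _≟'_)
    decImp : ∀ {A B : Set} → Dec A → Dec B → Dec (A → B)
    decImp _       (yes b) = yes (λ _ → b)
    decImp (no ¬a) _       = yes (λ a → Data.Empty.⊥-elim (¬a a))
      where import Data.Empty
    decImp (yes a) (no ¬b) = no (λ f → ¬b (f a))

  wPw : Vec Carrier n → ℕ
  wPw u = Σ[ (λ j → if ⌊ inM? u j ⌋ then w (lookup u j) else 0) ]
        + Σ[ (λ j → if ⌊ inI? u j ⌋ then (if ⌊ inM? u j ⌋ then 0 else 1) else 0) ] * Mw 𝔽 W

  dPw : Vec Carrier n → Vec Carrier n → ℕ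
  dPw u v = wPw (zipWith (λ a b → a ⊕ (⊝ b)) u v)

  IsMinDistance : List (Vec Carrier n) → ℕ → Set
  IsMinDistance C d =
      (∃ λ u → ∃ λ v → u ∈ C × v ∈ C × u ≢ v × dPw u v ≡ d)
    × (∀ u v → u ∈ C → v ∈ C → u ≢ v → d ≤ dPw u v)

-- Let k = ⌊(d − 1)/M_w⌋ ≤ n and let S be a down-set of P with exactly k elements (an initial
-- segment of a linear extension of P). If two codewords agree outside S, their difference is
-- supported in S, so its ideal lies in S and their distance is at most |S|·M_w ≤ d − 1; hence
-- distinct codewords already differ outside S. Reading the n − k coordinates outside S as
-- base-q digits is therefore injective on C, so |C| ≤ q^(n−k) and ⌈log_q |C|⌉ ≤ n − k.
module Submission where

open import Defs
open import Algebra.Structures using (IsCommutativeRing)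
open import Data.Bool using (Bool; true; false; if_then_else_; not; T)
open import Data.Empty using (⊥-elim)
open import Data.Fin as Fin using (Fin; zero; suc; combine; toℕ; fromℕ<)
open import Data.Fin.Properties
  using (suc-injective; combine-injectiveˡ; combine-injectiveʳ; combine-monoˡ-<; injective⇒≤;
         toℕ-injective; toℕ<n; toℕ-fromℕ<)
open import Data.List as List using (List; length)
open import Data.List.Membership.Propositional using (_∈_)
open import Data.List.Membership.Propositional.Properties using (∈-lookup)
open import Data.List.Relation.Unary.All as All using ()
open import Data.List.Relation.Unary.AllPairs using (_∷_)
open import Data.List.Relation.Unary.Unique.Propositional using (Unique)
open import Data.Nat using (ℕ; zero; suc; _+_; _*_; _∸_; _^_; _⊔_; _≤_; _<_; z≤n; s≤s; _≤ᵇ_; _<ᵇ_; _≡ᵇ_)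
open import Data.Nat.DivMod using (m/n*n≤m)
open import Data.Nat.Properties hiding (suc-injective)
open import Algebra.Properties.Semiring.Sum +-*-semiring using (sum; ∑-distrib-+; *-distribʳ-sum)
open import Data.Product using (∃; _×_; _,_; proj₁)
open import Data.Vec using (Vec; []; _∷_; lookup; zipWith; tabulate; foldr′)
open import Data.Vec.Properties using (tabulate∘lookup; tabulate-cong; lookup-zipWith)
open import Function using (_∘_; case_of_)
open import Function.Bundles using (Inverse; Injection; _↣_)
open import Function.Definitions using (Injective)
open import Function.Properties.Inverse using (↔-sym; ↔⇒↣)
open import Relation.Binary using (IsDecPartialOrder)
open import Relation.Binary.PropositionalEquality
  using (_≡_; _≢_; refl; sym; trans; cong; cong₂; subst; subst₂; module ≡-Reasoning)
open import Relation.Nullary using (¬_; yes; no; contradiction)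
open import Relation.Nullary.Decidable using (⌊_⌋; toWitness; fromWitness)

𝟙 : Bool → ℕ
𝟙 b = if b then 1 else 0

∣_∣ : ∀ {n} → (Fin n → Bool) → ℕ
∣ S ∣ = sum (𝟙 ∘ S)

_⊆_ : ∀ {n} → (Fin n → Bool) → (Fin n → Bool) → Set
S ⊆ S′ = ∀ {i} → T (S i) → T (S′ i)

∁ : ∀ {n} → (Fin n → Bool) → Fin n → Bool
∁ S = not ∘ S

sum-mono-≤ : ∀ {n} {f g : Fin n → ℕ} → (∀ i → f i ≤ g i) → sum f ≤ sum g
sum-mono-≤ {zero}  _   = z≤n
sum-mono-≤ {suc n} f≤g = +-mono-≤ (f≤g zero) (sum-mono-≤ (f≤g ∘ suc))

Σ≡sum : ∀ {n} (f : Fin n → ℕ) → Σ[ f ] ≡ sum f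
Σ≡sum {zero}  f = refl
Σ≡sum {suc n} f = cong (f zero +_) (Σ≡sum (f ∘ suc))

≤-foldr-⊔ : ∀ {n} (g : Fin n → ℕ) i → g i ≤ foldr′ _⊔_ 0 (tabulate g)
≤-foldr-⊔ g zero    = m≤m⊔n _ _
≤-foldr-⊔ g (suc i) = ≤-trans (≤-foldr-⊔ (g ∘ suc) i) (m≤n⊔m _ _)

𝟙-mono : ∀ a b → (T a → T b) → 𝟙 a ≤ 𝟙 b
𝟙-mono false _     _   = z≤n
𝟙-mono true  true  _   = ≤-refl
𝟙-mono true  false a⇒b = ⊥-elim (a⇒b _)

∣∅∣≡0 : ∀ {n} → ∣ (λ (_ : Fin n) → false) ∣ ≡ 0
∣∅∣≡0 {zero}  = refl
∣∅∣≡0 {suc n} = ∣∅∣≡0 {n}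

∣⊤∣≡n : ∀ {n} → ∣ (λ (_ : Fin n) → true) ∣ ≡ n
∣⊤∣≡n {zero}  = refl
∣⊤∣≡n {suc n} = cong suc ∣⊤∣≡n

∣∣-mono : ∀ {n} {S S′ : Fin n → Bool} → S ⊆ S′ → ∣ S ∣ ≤ ∣ S′ ∣
∣∣-mono {S = S} {S′} S⊆S′ = sum-mono-≤ (λ i → 𝟙-mono (S i) (S′ i) S⊆S′)

∣∣-mono-< : ∀ {n} {S S′ : Fin n → Bool} → S ⊆ S′ →
            ∀ {i} → T (S′ i) → ¬ T (S i) → ∣ S ∣ < ∣ S′ ∣
∣∣-mono-< {suc n} {S} {S′} S⊆S′ {zero} i∈S′ i∉S with S zero | S′ zero
... | false | true = s≤s (∣∣-mono {S = S ∘ suc} {S′ ∘ suc} S⊆S′)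
... | true  | _    = contradiction _ i∉S
∣∣-mono-< {suc n} {S} {S′} S⊆S′ {suc i} i∈S′ i∉S =
  ≤-trans (≤-reflexive (sym (+-suc _ _)))
    (+-mono-≤ (𝟙-mono (S zero) (S′ zero) S⊆S′)
              (∣∣-mono-< {S = S ∘ suc} {S′ ∘ suc} S⊆S′ i∈S′ i∉S))

∣S∣≤n : ∀ {n} (S : Fin n → Bool) → ∣ S ∣ ≤ n
∣S∣≤n S = ≤-trans (∣∣-mono {S = S} {λ _ → true} (λ _ → _)) (≤-reflexive ∣⊤∣≡n)

∣S∣+∣∁S∣≡n : ∀ {n} (S : Fin n → Bool) → ∣ S ∣ + ∣ ∁ S ∣ ≡ n
∣S∣+∣∁S∣≡n {zero}  S = refl
∣S∣+∣∁S∣≡n {suc n} S with S zero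
... | true  = cong suc (∣S∣+∣∁S∣≡n (S ∘ suc))
... | false = trans (+-suc _ _) (cong suc (∣S∣+∣∁S∣≡n (S ∘ suc)))

∣S∣≡0⇒∁S-full : ∀ {n} {S : Fin n → Bool} → ∣ S ∣ ≡ 0 → ∀ i → T (∁ S i)
∣S∣≡0⇒∁S-full {S = S} ∣S∣≡0 i with S i in S-i
... | false = _
... | true  = contradiction (subst (1 ≤_) ∣S∣≡0 0<∣S∣) λ ()
  where
  0<∣S∣ : 0 < ∣ S ∣
  0<∣S∣ = ≤-trans (s≤s z≤n)
                  (∣∣-mono-< {S = λ _ → false} {S} (λ ()) (subst T (sym S-i) _) (λ ()))

subsingleton⇒∣S∣≤1 : ∀ {n} {S : Fin n → Bool} →
                     (∀ {i j} → T (S i) → T (S j) → i ≡ j) → ∣ S ∣ ≤ 1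
subsingleton⇒∣S∣≤1 {zero}          _      = z≤n
subsingleton⇒∣S∣≤1 {suc n} {S} unique with S zero in S₀
... | true  =
  s≤s (≤-trans (∣∣-mono {S = S ∘ suc} {λ _ → false} tail-empty) (≤-reflexive (∣∅∣≡0 {n})))
  where
  tail-empty : ∀ {j} → T (S (suc j)) → T false
  tail-empty j∈S = case unique (subst T (sym S₀) _) j∈S of λ ()
... | false = subsingleton⇒∣S∣≤1 {S = S ∘ suc} (λ i∈S j∈S → suc-injective (unique i∈S j∈S))

discrete-intermediate-value : (f : ℕ → ℕ) → (∀ K → f (suc K) ≤ suc (f K)) →
                              ∀ N {k} → f 0 ≤ k → k ≤ f N → ∃ λ K → f K ≡ k
discrete-intermediate-value f step zero    f0≤k k≤f0 = 0 , ≤-antisym f0≤k k≤f0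
discrete-intermediate-value f step (suc N) {k} f0≤k k≤f[N+1] with k ≤? f N
... | yes k≤fN = discrete-intermediate-value f step N f0≤k k≤fN
... | no  k≰fN = suc N , ≤-antisym (≤-trans (step N) (≰⇒> k≰fN)) k≤f[N+1]

module LinearSearch (p : ℕ → Bool) (t : ℕ) (p-t : T (p t)) (search : ℕ → ℕ → ℕ)
  (search-zero : ∀ k → search 0 k ≡ k)
  (search-suc  : ∀ f k → search (suc f) k ≡ (if p k then k else search f (suc k))) where

  search-≤ : ∀ f k → k ≤ t → search f k ≤ t
  search-≤ zero    k k≤t rewrite search-zero k = k≤t
  search-≤ (suc f) k k≤t rewrite search-suc f k with p k in p-k
  ... | true  = k≤t
  ... | false = search-≤ f (suc k) (≤∧≢⇒< k≤t λ { refl → subst T p-k p-t })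

2≤q^t⇒1≤t : ∀ {q m t} → (m <ᵇ 1) ≡ false → suc m ≤ q ^ t → 1 ≤ t
2≤q^t⇒1≤t {t = suc t} _  _        = s≤s z≤n
2≤q^t⇒1≤t {m = zero}  {zero} () _
2≤q^t⇒1≤t {m = suc m} {zero} _  (s≤s ())

-- The search loop of ceilLog is local to Defs. The metavariable ceilLog-search is solved by
-- unification against it in the last clause, which abstracts suc m and 1 so that the loop
-- appears applied to variables only.
mutual
  ceilLog-search : ℕ → ℕ → ℕ → ℕ → ℕ
  ceilLog-search = _

  ceilLog-≤ : ∀ {q m t} → m ≤ q ^ t → ceilLog q m ≤ t
  ceilLog-≤ {m = zero} _ = z≤n
  ceilLog-≤ {q} {suc m} {t} m≤q^t with m <ᵇ 1 in m≮1
  ... | true  = z≤n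
  ... | false with suc m | m≤q^t | 1 | 2≤q^t⇒1≤t {q} {m} {t} m≮1 m≤q^t
  ...   | X | X≤q^t | k | k≤t =
    LinearSearch.search-≤ (λ k → X ≤ᵇ q ^ k) t (≤⇒≤ᵇ X≤q^t) (ceilLog-search q X)
      (λ _ → refl) (λ _ _ → refl) m k k≤t

floorDiv*≤ : ∀ m M → floorDiv m M * M ≤ m
floorDiv*≤ m zero    = z≤n
floorDiv*≤ m (suc M) = m/n*n≤m m (suc M)

floorDiv-pred-≤ : ∀ {d M n} → d ≤ n * M → floorDiv (d ∸ 1) M ≤ n
floorDiv-pred-≤ {M = zero}      _      = z≤n
floorDiv-pred-≤ {d} {suc M} {n} d≤nM =
  *-cancelʳ-≤ _ n (suc M) (≤-trans (floorDiv*≤ (d ∸ 1) (suc M)) (≤-trans (m∸n≤m d 1) d≤nM))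

floorDiv-pred-≡0 : ∀ d M → d ≤ floorDiv (d ∸ 1) M * M → floorDiv (d ∸ 1) M ≡ 0
floorDiv-pred-≡0 zero    zero    _   = refl
floorDiv-pred-≡0 zero    (suc M) _   = refl
floorDiv-pred-≡0 (suc d) M       d<d = contradiction (≤-trans d<d (floorDiv*≤ d M)) (n≮n d)

AgreeOn : ∀ {A : Set} {n} → (Fin n → Bool) → Vec A n → Vec A n → Set
AgreeOn S u v = ∀ i → T (S i) → lookup u i ≡ lookup v i

AgreeOn-everywhere⇒≡ : ∀ {A : Set} {n} {S : Fin n → Bool} {u v : Vec A n} →
                       (∀ i → T (S i)) → AgreeOn S u v → u ≡ v
AgreeOn-everywhere⇒≡ {u = u} {v} S-full agree =
  trans (sym (tabulate∘lookup u)) (trans (tabulate-cong (λ i → agree i (S-full i))) (tabulate∘lookup v))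

lookup-≢ : ∀ {A : Set} {xs : List A} → Unique xs →
           ∀ {i j} → i ≢ j → List.lookup xs i ≢ List.lookup xs j
lookup-≢ (_  ∷ _)      {zero}  {zero}  i≢j = contradiction refl i≢j
lookup-≢ (x∉ ∷ _)      {zero}  {suc j} _   = All.lookup x∉ (∈-lookup j)
lookup-≢ (x∉ ∷ _)      {suc i} {zero}  _   = All.lookup x∉ (∈-lookup i) ∘ sym
lookup-≢ (_  ∷ unique) {suc i} {suc j} i≢j = lookup-≢ unique (i≢j ∘ cong suc)

length-≤ : ∀ {A : Set} {m} {xs : List A} → Unique xs → (f : A → Fin m) →
           (∀ {x y} → x ∈ xs → y ∈ xs → x ≢ y → f x ≢ f y) → length xs ≤ m
length-≤ {xs = xs} unique f f-separates = injective⇒≤ f∘lookup-injective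
  where
  f∘lookup-injective : Injective _≡_ _≡_ (f ∘ List.lookup xs)
  f∘lookup-injective {i} {j} eq with i Fin.≟ j
  ... | yes i≡j = i≡j
  ... | no  i≢j = contradiction eq (f-separates (∈-lookup i) (∈-lookup j) (lookup-≢ unique i≢j))

module _ {A : Set} {q} (ι : A ↣ Fin q) where
  open Injection ι renaming (to to digit)

  digitsOn : ∀ {n} (S : Fin n → Bool) → Vec A n → Fin (q ^ ∣ S ∣)
  digitsOn S []      = zero
  digitsOn S (a ∷ u) with S zero
  ... | true  = combine (digit a) (digitsOn (S ∘ suc) u)
  ... | false = digitsOn (S ∘ suc) u

  digitsOn-injective : ∀ {n} (S : Fin n → Bool) (u v : Vec A n) →
                       digitsOn S u ≡ digitsOn S v → AgreeOn S u v
  digitsOn-injective S (a ∷ u) (b ∷ v) eq zero i∈S with S zero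
  ... | true = injective (combine-injectiveˡ (digit a) (digitsOn (S ∘ suc) u) (digit b) _ eq)
  digitsOn-injective S (a ∷ u) (b ∷ v) eq (suc i) i∈S with S zero
  ... | true  = digitsOn-injective (S ∘ suc) u v
                  (combine-injectiveʳ (digit a) (digitsOn (S ∘ suc) u) (digit b) _ eq) i i∈S
  ... | false = digitsOn-injective (S ∘ suc) u v eq i i∈S

  length≤q^∣S∣ : ∀ {n} {C : List (Vec A n)} {S} → Unique C →
                 (∀ {u v} → u ∈ C → v ∈ C → u ≢ v → ¬ AgreeOn S u v) → length C ≤ q ^ ∣ S ∣
  length≤q^∣S∣ {S = S} unique differ =
    length-≤ unique (digitsOn S)
      (λ {u} {v} u∈C v∈C u≢v → differ u∈C v∈C u≢v ∘ digitsOn-injective S u v)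

module Thresholds {n N} (key : Fin n → Fin N) (key-injective : Injective _≡_ _≡_ key) where

  below : ℕ → Fin n → Bool
  below K j = toℕ (key j) <ᵇ K

  ∣below∣-step : ∀ K → ∣ below (suc K) ∣ ≤ suc ∣ below K ∣
  ∣below∣-step K = begin
    ∣ below (suc K) ∣                        ≤⟨ sum-mono-≤ (λ j → split (toℕ (key j)) K) ⟩
    sum (λ j → 𝟙 (below K j) + 𝟙 (fiber j)) ≡⟨ ∑-distrib-+ (𝟙 ∘ below K) (𝟙 ∘ fiber) ⟩
    ∣ below K ∣ + ∣ fiber ∣                   ≤⟨ +-monoʳ-≤ _ (subsingleton⇒∣S∣≤1 fiber-subsingleton) ⟩
    ∣ below K ∣ + 1                          ≡⟨ +-comm _ 1 ⟩
    suc ∣ below K ∣                          ∎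
    where
    open ≤-Reasoning
    fiber : Fin n → Bool
    fiber j = toℕ (key j) ≡ᵇ K
    fiber-subsingleton : ∀ {i j} → T (fiber i) → T (fiber j) → i ≡ j
    fiber-subsingleton i∈ j∈ =
      key-injective (toℕ-injective (trans (≡ᵇ⇒≡ _ _ i∈) (sym (≡ᵇ⇒≡ _ _ j∈))))
    split : ∀ x K → 𝟙 (x <ᵇ suc K) ≤ 𝟙 (x <ᵇ K) + 𝟙 (x ≡ᵇ K)
    split zero    zero    = ≤-refl
    split zero    (suc K) = s≤s z≤n
    split (suc x) zero    = z≤n
    split (suc x) (suc K) = split x K

  ∣below∣-surjective : ∀ {k} → k ≤ n → ∃ λ K → ∣ below K ∣ ≡ k
  ∣below∣-surjective k≤n = discrete-intermediate-value (λ K → ∣ below K ∣) ∣below∣-step N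
    (≤-trans (≤-reflexive (∣∅∣≡0 {n})) z≤n)
    (≤-trans k≤n (≤-trans (≤-reflexive (sym (∣⊤∣≡n {n})))
                          (∣∣-mono {S = λ _ → true} {below N} (λ {j} _ → <⇒<ᵇ (toℕ<n (key j))))))

module _ {n} (P : FinPoset n) where
  open FinPoset P
  open IsDecPartialOrder isDecPartialOrder using (antisym) renaming (refl to ≼-refl; trans to ≼-trans)

  IsDownSet : (Fin n → Bool) → Set
  IsDownSet S = ∀ {i j} → j ≼ i → T (S i) → T (S j)

  -- Ordering Fin n by height first and index second is a linear extension of ≼.
  private
    ↓ : Fin n → Fin n → Bool
    ↓ i j = ⌊ j ≼? i ⌋

    height : Fin n → Fin (suc n)
    height i = fromℕ< (s≤s (∣S∣≤n (↓ i)))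

    height-< : ∀ {i j} → j ≼ i → j ≢ i → height j Fin.< height i
    height-< {i} {j} j≼i j≢i = subst₂ _<_ (sym (toℕ-fromℕ< _)) (sym (toℕ-fromℕ< _))
      (∣∣-mono-< {S = ↓ j} {↓ i} (λ k≼j → fromWitness (≼-trans (toWitness k≼j) j≼i))
        (fromWitness ≼-refl) (λ i≼j → j≢i (antisym j≼i (toWitness i≼j))))

    key : Fin n → Fin (suc n * n)
    key i = combine (height i) i

    key-injective : Injective _≡_ _≡_ key
    key-injective {i} {j} = combine-injectiveʳ (height i) i (height j) j

    key-monotone : ∀ {i j} → j ≼ i → toℕ (key j) ≤ toℕ (key i)
    key-monotone {i} {j} j≼i with j Fin.≟ i
    ... | yes refl = ≤-refl
    ... | no  j≢i  = <⇒≤ (combine-monoˡ-< j i (height-< j≼i j≢i))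

  open Thresholds key key-injective using (below; ∣below∣-surjective)

  downset-of-size : ∀ {k} → k ≤ n → ∃ λ S → IsDownSet S × ∣ S ∣ ≡ k
  downset-of-size k≤n with K , ∣below∣≡k ← ∣below∣-surjective k≤n =
    below K , below-down , ∣below∣≡k
    where
    below-down : IsDownSet (below K)
    below-down {i} j≼i i∈S = <⇒<ᵇ (≤-<-trans (key-monotone j≼i) (<ᵇ⇒< (toℕ (key i)) K i∈S))

module _ {q n} (𝔽 : FiniteField q) (P : FinPoset n) (W : Weight 𝔽) where
  open FiniteField 𝔽
  open Weight W
  open IsCommutativeRing isCommutativeRing using (-‿inverseʳ)

  _−_ : Vec Carrier n → Vec Carrier n → Vec Carrier n
  u − v = zipWith (λ a b → a ⊕ (⊝ b)) u v

  I? : Vec Carrier n → Fin n → Bool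
  I? u j = ⌊ inI? 𝔽 P W u j ⌋

  w≤Mw : ∀ α → w α ≤ Mw 𝔽 W
  w≤Mw α = subst (λ β → w β ≤ Mw 𝔽 W) (Inverse.strictlyInverseˡ enum α)
                 (≤-foldr-⊔ (w ∘ Inverse.to enum) (Inverse.from enum α))

  wPw≤∣I∣*Mw : ∀ u → wPw 𝔽 P W u ≤ ∣ I? u ∣ * Mw 𝔽 W
  wPw≤∣I∣*Mw u = begin
    Σ[ A ] + Σ[ B ] * M            ≡⟨ cong₂ (λ a b → a + b * M) (Σ≡sum A) (Σ≡sum B) ⟩
    sum A + sum B * M              ≡⟨ cong (sum A +_) (*-distribʳ-sum M B) ⟩
    sum A + sum (λ j → B j * M)    ≡⟨ ∑-distrib-+ A (λ j → B j * M) ⟨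
    sum (λ j → A j + B j * M)      ≤⟨ sum-mono-≤ (λ j → pointwise (inM⇒inI j) (w≤Mw (lookup u j))) ⟩
    sum (λ j → 𝟙 (I? u j) * M)     ≡⟨ *-distribʳ-sum M (𝟙 ∘ I? u) ⟨
    ∣ I? u ∣ * M                   ∎
    where
    open ≤-Reasoning
    M : ℕ
    M = Mw 𝔽 W
    M? : Fin n → Bool
    M? j = ⌊ inM? 𝔽 P W u j ⌋
    A B : Fin n → ℕ
    A j = if M? j then w (lookup u j) else 0
    B j = if I? u j then (if M? j then 0 else 1) else 0
    inM⇒inI : ∀ j → T (M? j) → T (I? u j)
    inM⇒inI j j∈M = fromWitness (proj₁ (toWitness j∈M))
    pointwise : ∀ {m i x} → (T m → T i) → x ≤ M →
                (if m then x else 0) + (if i then (if m then 0 else 1) else 0) * M ≤ 𝟙 i * M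
    pointwise {true}  {true}  _   x≤M = subst₂ _≤_ (sym (+-identityʳ _)) (sym (+-identityʳ M)) x≤M
    pointwise {true}  {false} m⇒i _   = ⊥-elim (m⇒i _)
    pointwise {false} {true}  _   _   = ≤-refl
    pointwise {false} {false} _   _   = ≤-refl

  minDistance≤n*Mw : ∀ {C d} → IsMinDistance 𝔽 P W C d → d ≤ n * Mw 𝔽 W
  minDistance≤n*Mw ((u , v , _ , _ , _ , dPw≡d) , _) =
    subst (_≤ n * Mw 𝔽 W) dPw≡d
      (≤-trans (wPw≤∣I∣*Mw (u − v)) (*-monoˡ-≤ (Mw 𝔽 W) (∣S∣≤n (I? (u − v)))))

  dPw≤∣S∣*Mw : ∀ {S} u v → IsDownSet P S → AgreeOn (∁ S) u v → dPw 𝔽 P W u v ≤ ∣ S ∣ * Mw 𝔽 W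
  dPw≤∣S∣*Mw {S} u v S-down agree =
    ≤-trans (wPw≤∣I∣*Mw (u − v)) (*-monoˡ-≤ (Mw 𝔽 W) (∣∣-mono {S = I? (u − v)} {S} I⊆S))
    where
    supp⊆S : ∀ i → supp 𝔽 P W (u − v) i → T (S i)
    supp⊆S i i∈supp with S i in S-i
    ... | true  = _
    ... | false = contradiction (begin
        lookup (u − v) i               ≡⟨ lookup-zipWith _ i u v ⟩
        lookup u i ⊕ (⊝ lookup v i)    ≡⟨ cong (λ b → lookup u i ⊕ (⊝ b)) (agree i i∉S) ⟨
        lookup u i ⊕ (⊝ lookup u i)    ≡⟨ -‿inverseʳ _ ⟩
        0#                             ∎) i∈supp
      where
      open ≡-Reasoning
      i∉S : T (∁ S i)
      i∉S = subst (T ∘ not) (sym S-i) _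
    I⊆S : I? (u − v) ⊆ S
    I⊆S j∈I with i , i∈supp , j≼i ← toWitness j∈I = S-down j≼i (supp⊆S i i∈supp)

  -- Codewords agreeing off S are within |S|·M_w ≤ d − 1 of each other; since d ≤ d ∸ 1 only
  -- for d = 0, where S is empty, they must coincide.
  differ-off-downset : ∀ {C d S} → IsMinDistance 𝔽 P W C d →
                       IsDownSet P S → ∣ S ∣ ≡ floorDiv (d ∸ 1) (Mw 𝔽 W) →
                       ∀ {u v} → u ∈ C → v ∈ C → u ≢ v → ¬ AgreeOn (∁ S) u v
  differ-off-downset {d = d} {S} (_ , d-minimal) S-down ∣S∣≡k {u} {v} u∈C v∈C u≢v agree =
    u≢v (AgreeOn-everywhere⇒≡ (∣S∣≡0⇒∁S-full ∣S∣≡0) agree)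
    where
    open ≤-Reasoning
    M : ℕ
    M = Mw 𝔽 W
    ∣S∣≡0 : ∣ S ∣ ≡ 0
    ∣S∣≡0 = trans ∣S∣≡k (floorDiv-pred-≡0 d M (begin
      d                           ≤⟨ d-minimal u v u∈C v∈C u≢v ⟩
      dPw 𝔽 P W u v               ≤⟨ dPw≤∣S∣*Mw u v S-down agree ⟩
      ∣ S ∣ * M                   ≡⟨ cong (_* M) ∣S∣≡k ⟩
      floorDiv (d ∸ 1) M * M      ∎))

corollary4p1 : ∀ {q n : ℕ} (𝔽 : FiniteField q) (P : FinPoset n) (W : Weight 𝔽)
    (C : List (Vec (FiniteField.Carrier 𝔽) n)) → Unique C → 2 ≤ length C →
    (d : ℕ) → IsMinDistance 𝔽 P W C d →
    floorDiv (d ∸ 1) (Mw 𝔽 W) + ceilLog q (length C) ≤ n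
corollary4p1 {q} {n} 𝔽 P W C unique _ d d-min
  with S , S-down , ∣S∣≡k ← downset-of-size P (floorDiv-pred-≤ (minDistance≤n*Mw 𝔽 P W d-min)) = begin
    k + ceilLog q (length C)  ≤⟨ +-monoʳ-≤ k (ceilLog-≤ (length≤q^∣S∣ ι unique differ)) ⟩
    k + ∣ ∁ S ∣               ≡⟨ cong (_+ ∣ ∁ S ∣) ∣S∣≡k ⟨
    ∣ S ∣ + ∣ ∁ S ∣           ≡⟨ ∣S∣+∣∁S∣≡n S ⟩
    n                         ∎
  where
  open ≤-Reasoning
  k : ℕ
  k = floorDiv (d ∸ 1) (Mw 𝔽 W)
  ι : FiniteField.Carrier 𝔽 ↣ Fin q
  ι = ↔⇒↣ (↔-sym (FiniteField.enum 𝔽))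
  differ : ∀ {u v} → u ∈ C → v ∈ C → u ≢ v → ¬ AgreeOn (∁ S) u v
  differ = differ-off-downset 𝔽 P W d-min S-down ∣S∣≡k
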